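{- Let $G_1,\dots,G_n$ be groups and let $G\le G_1\times\dots\times G_n$ be a subgroup whose projections to each $G_i$ are surjective and which has abelian entanglements with respect to $G_1\times\dots\times G_n$. Let $S\subseteq\{1,\dots,n\}$ be nonempty and let $G_S$ be the image of $G$ under the projection $\pi_S:G_1\times\dots\times G_n\to\prod_{i\in S}G_i$. Then $G_S$ has abelian entanglements with respect to $\prod_{i\in S}G_i$.
   Context: For a subgroup $H\le H_1\times\dots\times H_k$ with surjective projections onto each $H_i$, and a partition $\{A,B\}$ of $\{1,\dots,k\}$ into two nonempty sets, let $H_A$, $H_B$ be the images of $H$ in $\prod_{i\in A}H_i$, $\prod_{i\in B}H_i$; then $H\le H_A\times H_B$ with surjective projections, and its Goursat quotient is $H_A/\pi_A(H\cap(H_A\times\{1\}))$. $H$ has abelian entanglements with respect to $H_1\times\dots\times H_k$ if this Goursat quotient is abelian for every such two-set partition (vacuous if $k=1$). -}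

module Defs where

open import Level using (Level; _⊔_; suc)
open import Algebra.Bundles using (Group)
open import Data.Bool using (Bool; true; false)
open import Data.Product using (Σ; ∃; _×_; _,_; proj₁)
open import Data.Fin using (Fin)
open import Data.Fin.Subset using (Subset; _∈_)
open import Relation.Binary.PropositionalEquality using (_≡_)

private
  variable
    c ℓ p : Level

module _ {I : Set} (G : I → Group c ℓ) where
  open Group

  Π : Set c
  Π = (i : I) → Carrier (G i)

  _≋_ : Π → Π → Set ℓ
  x ≋ y = (i : I) → _≈_ (G i) (x i) (y i)

  _·_ : Π → Π → Π
  (x · y) i = _∙_ (G i) (x i) (y i)

  e : Π
  e i = ε (G i)

  inv : Π → Π
  inv x i = _⁻¹ (G i) (x i)

  record IsSubgroup (H : Π → Set p) : Set (c ⊔ ℓ ⊔ p) where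
    field
      resp  : ∀ {x y} → x ≋ y → H x → H y
      has-e : H e
      ·-closed : ∀ {x y} → H x → H y → H (x · y)
      inv-closed : ∀ {x} → H x → H (inv x)

  SurjectiveProjections : (H : Π → Set p) → Set (c ⊔ ℓ ⊔ p)
  SurjectiveProjections H =
    (i : I) (a : Carrier (G i)) → Σ Π (λ h → H h × _≈_ (G i) (h i) a)

  -- A partition {A,B} of the index set is given by
  -- A : I → Bool (A = true-part, B = false-part), both parts nonempty.
  -- H_A = π_A(H), N = π_A(H ∩ (H_A × {1})).  H_A / N is abelian iff for all
  -- x = π_A h, y = π_A h' in H_A, the cosets xyN and yxN agree, i.e.
  -- (yx)⁻¹(xy) ∈ N, i.e. there is g ∈ H, trivial on B, with
  -- π_A g = π_A((h'h)⁻¹(hh')).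
  AbelianEntanglements : (H : Π → Set p) → Set (c ⊔ ℓ ⊔ p)
  AbelianEntanglements H =
    (A : I → Bool) → (∃ λ i → A i ≡ true) → (∃ λ i → A i ≡ false) →
    (h h' : Π) → H h → H h' →
    Σ Π (λ g → H g
      × ((i : I) → A i ≡ false → _≈_ (G i) (g i) (ε (G i)))
      × ((i : I) → A i ≡ true →
           _≈_ (G i) (g i) ((inv (h' · h) · (h · h')) i)))

Idx : {n : _} → Subset n → Set
Idx {n} S = Σ (Fin n) (λ i → i ∈ S)

restrict : {n : _} (G : Fin n → Group c ℓ) (S : Subset n) →
  Π G → Π (λ (j : Idx S) → G (proj₁ j))
restrict G S x j = x (proj₁ j)

image : {n : _} (G : Fin n → Group c ℓ) (S : Subset n) →
  (H : Π G → Set p) → Π (λ (j : Idx S) → G (proj₁ j)) → Set (c ⊔ ℓ ⊔ p)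
image G S H y =
  Σ (Π G) (λ h → H h × _≋_ (λ (j : Idx S) → G (proj₁ j)) (restrict G S h) y)

module Submission where

-- A two-set partition {A', B'} of S extends to a two-set partition {A, B}
-- of {1,…,n} by adding every index outside S to the B-side, so A = A'.
-- Both parts stay nonempty, and on S the new partition agrees with the old.
-- Given x = π_S h and y = π_S h' in G_S, abelian entanglements of G for
-- {A, B} yield g ∈ G that is trivial on B and equals the commutator-type
-- element [h, h'] = (h'h)⁻¹(hh') on A. Its restriction π_S g lies in G_S,
-- is trivial on B' ⊆ B, and on A' = A agrees with [x, y], because π_S is
-- computed pointwise and [−,−] respects pointwise equality.

open import Defs
open import Level using (Level)
open import Algebra.Bundles using (Group)
open import Data.Nat using (ℕ)
open import Data.Fin using (Fin)
open import Data.Fin.Subset using (Subset; Nonempty; _∈_)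
open import Data.Fin.Subset.Properties using (_∈?_)
open import Data.Product using (∃; proj₁; proj₂; _,_)
open import Data.Bool using (Bool; false)
open import Data.Vec.Properties.WithK using ([]=-irrelevant)
open import Relation.Nullary using (yes; no)
open import Relation.Binary.PropositionalEquality using (_≡_; trans; cong)
open import Data.Empty using (⊥-elim)

module _ {n : ℕ} (S : Subset n) (A' : Idx S → Bool) where

  extend : Fin n → Bool
  extend i with i ∈? S
  ... | yes i∈S = A' (i , i∈S)
  ... | no  _   = false

  -- On S the extension agrees with A'; this needs that proofs of i ∈ S
  -- are unique, since A' may depend on them.
  extend-agrees : (j : Idx S) → extend (proj₁ j) ≡ A' j
  extend-agrees (i , i∈S) with i ∈? S
  ... | yes i∈S′ = cong (λ q → A' (i , q)) ([]=-irrelevant i∈S′ i∈S)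
  ... | no  i∉S  = ⊥-elim (i∉S i∈S)

  extend-inhabited : {b : Bool} → ∃ (λ j → A' j ≡ b) → ∃ (λ i → extend i ≡ b)
  extend-inhabited (j , A'j≡b) = proj₁ j , trans (extend-agrees j) A'j≡b

-- The element [x, y] = (yx)⁻¹(xy) of a product of groups, whose membership
-- in the normal subgroup N expresses that x and y commute in H_A / N.
commutator : {c ℓ : Level} {I : Set} (G : I → Group c ℓ) → Π G → Π G → Π G
commutator G x y = _·_ G (inv G (_·_ G y x)) (_·_ G x y)

commutator-cong : {c ℓ : Level} {I : Set} (G : I → Group c ℓ) {x x′ y y′ : Π G} →
  _≋_ G x x′ → _≋_ G y y′ → _≋_ G (commutator G x y) (commutator G x′ y′)
commutator-cong G x≋x′ y≋y′ i =
  ∙-cong (⁻¹-cong (∙-cong (y≋y′ i) (x≋x′ i))) (∙-cong (x≋x′ i) (y≋y′ i))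
  where open Group (G i)

proposition2p7 : {c ℓ p : Level} (n : ℕ) (G : Fin n → Group c ℓ)
    (H : Π G → Set p) → IsSubgroup G H → SurjectiveProjections G H →
    AbelianEntanglements G H →
    (S : Subset n) → Nonempty S →
    AbelianEntanglements (λ (j : Idx S) → G (proj₁ j)) (image G S H)
proposition2p7 n G H _ _ entangled S _ A' A'-inhabited B'-inhabited
               x y (h , h∈H , πh≋x) (h′ , h′∈H , πh′≋y)
  with entangled (extend S A') (extend-inhabited S A' A'-inhabited)
                 (extend-inhabited S A' B'-inhabited) h h′ h∈H h′∈H
... | g , g∈H , g-trivial-on-B , g-on-A =
  restrict G S g , (g , g∈H , λ j → Group.refl (G (proj₁ j))) ,
  (λ j A'j≡false → g-trivial-on-B (proj₁ j) (trans (extend-agrees S A' j) A'j≡false)) ,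
  λ j A'j≡true → Group.trans (G (proj₁ j))
    (g-on-A (proj₁ j) (trans (extend-agrees S A' j) A'j≡true))
    (commutator-cong (λ (j : Idx S) → G (proj₁ j)) πh≋x πh′≋y j)
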